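{- Let $\alpha\ge1$ and suppose an algorithm for the maximum density subtree problem is available that, on any instance (a connected rooted graph with nonnegative vertex probabilities and positive edge lengths), returns a subtree containing the root whose density is at least $1/\alpha$ times the maximum density. Then the greedy algorithm (defined below) using this algorithm is a $4\alpha$-approximation algorithm for the expanding search problem: for every instance, the expanding search $\sigma^{\mathrm g}$ it returns satisfies $c(\sigma^{\mathrm g})\le 4\alpha\, c(\sigma^\star)$, where $\sigma^\star$ is an optimal expanding search.
   Context: Expanding search problem: $G=(V,E)$ is a connected graph with root $r$, probabilities $p_v\in[0,1]$ ($v\in V$) with $p_r=0$ and $\sum_v p_v=1$, and lengths $\lambda_e>0$ ($e\in E$); $n=|V\setminus\{r\}|$. An expanding search is a sequence of edges $\sigma=(e_1,\dots,e_n)$ with $r\in e_1$ such that each $e_k$ connects a not-yet-visited vertex to a previously visited vertex (visited vertices are $r$ and endpoints of earlier edges). For $v\in V$, $\lambda(v,\sigma)=\sum_{i=1}^k\lambda_{e_i}$ where $e_k$ is the first edge of $\sigma$ containing $v$ (and $\lambda(r,\sigma)=0$). The search cost is $c(\sigma)=\sum_{v\in V}p_v\lambda(v,\sigma)$; the problem is to minimize it. Maximum density subtree problem: among subtrees $T$ of a rooted graph containing the root, maximize the density $p(T)/\lambda(T)$, where $p(T)$ is the total probability of the vertices of $T$ and $\lambda(T)$ the total length of its edges. Contraction: for $S\subseteq V$ with $r\in S$, $G/S$ has vertex set $(V\setminus S)\cup\{r\}$ and edges: all $\{v,w\}\in E$ with $v,w\in V\setminus S$ (length $\lambda_{\{v,w\}}$),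 and an edge $\{r,w\}$ for each $w\in V\setminus S$ adjacent in $G$ to some vertex of $S$, with length $\lambda^S_{\{r,w\}}=\min\{\lambda_{\{v,w\}}:\{v,w\}\in E, v\in S\}$; probabilities are inherited. Greedy algorithm: set $i\gets1$, $S\gets\{r\}$. While some $v\in V\setminus S$ has $p_v>0$: let $T_i$ be the tree returned by the given MDSP algorithm on $G/S$ with these probabilities and lengths; let $\sigma_i$ be an arbitrary expanding search of the tree $T_i$; set $S\gets S\cup V[T_i]$ and increment $i$. Finally, $\sigma^{\mathrm g}$ is the expanding search obtained by concatenating $\sigma_1,\sigma_2,\dots$, replacing each edge incident to the root in a contracted graph by a corresponding length-minimizing edge of $G$ (followed by any completion to visit remaining zero-probability vertices).
   Formalization: The probabilities $p_v$, the edge lengths $\lambda_e$ and the factor $\alpha$ are rational rather than real, so the maximum density subtree algorithm is assumed to work only on instances with rational data. -}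

module Defs where

open import Data.Bool.Base using (Bool; true; false; _∧_; _∨_; not; if_then_else_)
open import Data.Nat.Base using (ℕ; suc)
open import Data.Fin.Base using (Fin)
open import Data.Fin.Properties using () renaming (_≟_ to _≟ᶠ_)
open import Data.Integer.Base using (+_)
open import Data.Rational.Base using (ℚ; 0ℚ; _+_; _*_; _÷_; _⊓_; _≤_; _<_; ≢-nonZero)
open import Data.Rational.Properties using () renaming (_≟_ to _≟ℚ_)
open import Data.List.Base using (List; []; _∷_; _++_; map; foldr; allFin; length)
open import Data.List.Membership.Propositional using (_∈_; _∉_)
open import Data.List.Relation.Binary.Permutation.Propositional using (_↭_)
open import Data.List.Relation.Binary.Pointwise using (Pointwise)
open import Data.Maybe.Base using (Maybe; just; nothing; fromMaybe)
open import Data.Product.Base using (_×_; _,_; proj₂; ∃; ∃-syntax)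
open import Data.Unit.Base using (⊤)
open import Relation.Nullary using (¬_; does; yes; no)
open import Relation.Binary.PropositionalEquality using (_≡_; _≢_)

-- An (oriented) edge (u , v): u is the already-visited endpoint,
-- v the newly reached endpoint.
Edge : ℕ → Set
Edge m = Fin m × Fin m

Is-just : Maybe ℚ → Set
Is-just x = ∃[ ℓ ] (x ≡ just ℓ)

_==_ : ∀ {m} → Fin m → Fin m → Bool
a == b = does (a ≟ᶠ b)

elem : ∀ {m} → Fin m → List (Fin m) → Bool
elem v []      = false
elem v (s ∷ S) = (v == s) ∨ elem v S

sumℚ : List ℚ → ℚ
sumℚ = foldr _+_ 0ℚ

-- Rooted graphs on a vertex set V ⊆ Fin m, with edge lengths and vertex
-- probabilities.  'len u v ≡ just ℓ' means {u,v} is an edge of length ℓ;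
-- 'len u v ≡ nothing' means there is no edge.

record Instance (m : ℕ) : Set where
  field
    vert : Fin m → Bool
    len  : Fin m → Fin m → Maybe ℚ
    root : Fin m
    prob : Fin m → ℚ
open Instance public

lenE : ∀ {m} → Instance m → Edge m → ℚ
lenE I (u , v) = fromMaybe 0ℚ (len I u v)

data Reach {m : ℕ} (I : Instance m) : Fin m → Set where
  here : Reach I (root I)
  step : ∀ {u v} → Reach I u → Is-just (len I u v) → Reach I v

WellFormed : ∀ {m} → Instance m → Set
WellFormed {m} I =
    (vert I (root I) ≡ true)
  × (∀ (u v : Fin m) → len I u v ≡ len I v u)
  × (∀ (v : Fin m) → len I v v ≡ nothing)
  × (∀ (u v : Fin m) (ℓ : ℚ) → len I u v ≡ just ℓ →
        (vert I u ≡ true) × (vert I v ≡ true) × (0ℚ < ℓ))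
  × (∀ (v : Fin m) → vert I v ≡ true → 0ℚ ≤ prob I v)
  × (∀ (v : Fin m) → vert I v ≡ true → Reach I v)

-- expanding-search instance: V = Fin (suc n), i.e. n non-root vertices,
-- p_r = 0, p_v ∈ [0,1], Σ p_v = 1.
ESInstance : ∀ {n} → Instance (suc n) → Set
ESInstance {n} G =
    WellFormed G
  × (∀ (v : Fin (suc n)) → vert G v ≡ true)
  × (prob G (root G) ≡ 0ℚ)
  × (∀ (v : Fin (suc n)) → (0ℚ ≤ prob G v) × (prob G v ≤ + 1 / 1))
  × (sumℚ (map (prob G) (allFin (suc n))) ≡ + 1 / 1)
  where open import Data.Rational.Base using (_/_)

ValidSeq : ∀ {m} → Instance m → List (Fin m) → List (Edge m) → Set
ValidSeq I vs []            = ⊤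
ValidSeq I vs ((u , v) ∷ σ) =
  (u ∈ vs) × (v ∉ vs) × Is-just (len I u v) × ValidSeq I (v ∷ vs) σ

ExpSearch : ∀ {n} → Instance (suc n) → List (Edge (suc n)) → Set
ExpSearch {n} G σ = ValidSeq G (root G ∷ []) σ × (length σ ≡ n)

arr : ∀ {m} → Instance m → Fin m → List (Edge m) → ℚ
arr I v []            = 0ℚ
arr I v ((a , b) ∷ σ) =
  lenE I (a , b) + (if (v == a) ∨ (v == b) then 0ℚ else arr I v σ)

arrival : ∀ {m} → Instance m → Fin m → List (Edge m) → ℚ
arrival I v σ = if v == root I then 0ℚ else arr I v σ

cost : ∀ {m} → Instance m → List (Edge m) → ℚ
cost {m} I σ = sumℚ (map (λ v → prob I v * arrival I v σ) (allFin m))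

-- A subtree containing the root is given by its edge list, each edge
-- oriented away from the root and listed in an order in which every edge
-- attaches a new vertex to the part already built (this orientation is
-- the unique one for a rooted tree).

IsSubtree : ∀ {m} → Instance m → List (Edge m) → Set
IsSubtree I T = ValidSeq I (root I ∷ []) T

treeVerts : ∀ {m} → Instance m → List (Edge m) → List (Fin m)
treeVerts I T = root I ∷ map proj₂ T

treeProb : ∀ {m} → Instance m → List (Edge m) → ℚ
treeProb I T = sumℚ (map (prob I) (treeVerts I T))

treeLen : ∀ {m} → Instance m → List (Edge m) → ℚ
treeLen I T = sumℚ (map (lenE I) T)

-- density p(T)/λ(T); by convention 0 for the trivial tree (λ(T) = 0)
ratio : ℚ → ℚ → ℚ
ratio a b with b ≟ℚ 0ℚ
... | yes _  = 0ℚ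
... | no b≢0 = _÷_ a b {{≢-nonZero b≢0}}

density : ∀ {m} → Instance m → List (Edge m) → ℚ
density I T = ratio (treeProb I T) (treeLen I T)

MDSPAlg : Set
MDSPAlg = ∀ {m} → Instance m → List (Edge m)

ApproxMDSP : ℚ → MDSPAlg → Set
ApproxMDSP α A =
  ∀ {m} (I : Instance m) → WellFormed I →
    IsSubtree I (A I)
  × (∀ (T : List (Edge m)) → IsSubtree I T → density I T ≤ α * density I (A I))

-- The vertex set becomes (V∖S) ∪ {r}; edges inside V∖S are kept; each
-- w ∈ V∖S adjacent to S gets an edge {r,w} of length min_{v∈S} λ_{v,w}.

minM : Maybe ℚ → Maybe ℚ → Maybe ℚ
minM nothing  y        = y
minM (just a) nothing  = just a
minM (just a) (just b) = just (a ⊓ b)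

minLen : ∀ {m} → Instance m → List (Fin m) → Fin m → Maybe ℚ
minLen I []      w = nothing
minLen I (s ∷ S) w = minM (len I s w) (minLen I S w)

contract : ∀ {m} → Instance m → List (Fin m) → Instance m
contract I S = record
  { vert = λ v → (v == root I) ∨ (vert I v ∧ not (elem v S))
  ; len  = λ u v →
      if elem u S
        then (if (u == root I) ∧ not (elem v S) then minLen I S v else nothing)
        else (if elem v S
                then (if v == root I then minLen I S u else nothing)
                else len I u v)
  ; root = root I
  ; prob = prob I
  }

-- Greedy algorithm, as a relation between a state (current set S) and the
-- possible remaining outputs (covering all arbitrary choices: the
-- expanding search σ_i of T_i, the length-minimising edge of G replacing
-- a root edge of G/S, and the final completion).

data LiftE {m : ℕ} (G : Instance m) (S : List (Fin m)) : Edge m → Edge m → Set where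
  rootEdge : ∀ {s w} → s ∈ S → len G s w ≡ minLen G S w →
             LiftE G S (root G , w) (s , w)
  keep     : ∀ {u v} → u ≢ root G → LiftE G S (u , v) (u , v)

data GreedyRun {m : ℕ} (A : MDSPAlg) (G : Instance m) :
               List (Fin m) → List (Edge m) → Set where
  done : ∀ {S τ} →
         (∀ (v : Fin m) → v ∉ S → ¬ (0ℚ < prob G v)) →
         ValidSeq G S τ →
         (∀ (v : Fin m) → v ∈ S ++ map proj₂ τ) →
         GreedyRun A G S τ
  iter : ∀ {S σ ρ rest} →
         (∃[ v ] (v ∉ S × (0ℚ < prob G v))) →
         σ ↭ A (contract G S) →
         ValidSeq (contract G S) (root G ∷ []) σ →
         Pointwise (LiftE G S) σ ρ →
         GreedyRun A G (S ++ map proj₂ (A (contract G S))) rest →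
         GreedyRun A G S (ρ ++ rest)

GreedyOutput : ∀ {m} → MDSPAlg → Instance m → List (Edge m) → Set
GreedyOutput A G σ = GreedyRun A G (root G ∷ []) σ

-- The cost of an expanding search is the area of its histogram, whose k-th column has the
-- length ℓₖ of the k-th edge as width and the probability mass qₖ still unvisited before
-- that edge as height.  A greedy iteration that starts with unvisited mass X and adds a tree
-- of length λ and mass P delays every unvisited vertex by at most λ, so the greedy cost is
-- at most Σ λ X over the iterations.  This is paid for by the potential 4α times the area
-- of the optimal histogram truncated at height X/2.  Contracting a prefix of length L of the
-- optimal search gives a subtree of G/S of length at most L carrying all mass that the
-- prefix visits outside S, so α-approximate maximality of the greedy density gives
-- λ X ≤ λ q + α P L, where q is the mass left unvisited by the prefix.  The iteration lowers
-- the truncation height by P/2, so every column of height at least X/2 loses 4α ℓ P/2; the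
-- prefix bound taken just before the first column below X/2 shows that the total loss
-- 2α P L is at least λ X.  Telescoping, the greedy cost is at most the initial potential,
-- which is at most 4α times the optimal cost.

{-# OPTIONS --safe #-}
module Submission where

open import Defs
open import Algebra.Bundles using (Ring)
open import Data.Bool.Base using (Bool; true; false; _∨_; _∧_; not; if_then_else_)
open import Data.Bool.Properties using (∨-zeroʳ; ∧-zeroʳ; ∧-identityʳ)
open import Data.Fin.Base using (Fin; zero; suc; punchIn)
open import Data.Fin.Properties using (punchInᵢ≢i) renaming (_≟_ to _≟ᶠ_)
open import Data.Fin.Subset using (Subset; ⁅_⁆; _∪_; ⊥; ⊤; ∣_∣; _⊂_) renaming (_∈_ to _∈ₛ_)
open import Data.Fin.Subset.Properties
  using (x∈p∪q⁻; x∈p∪q⁺; x∈⁅x⁆; x∈⁅y⁆⇒x≡y; ∉⊥; ∈⊤; q⊆p∪q; p⊂q⇒∣p∣<∣q∣; ∣p∣≤n; ∣p∣≡n⇒p≡⊤)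
open import Data.Integer.Base using (+_)
open import Data.List.Base using (List; []; _∷_; _++_; map; allFin; tabulate; length)
open import Data.List.Properties using (map-tabulate; ++-identityʳ; length-map)
open import Data.List.Membership.Propositional using (_∈_; _∉_)
open import Data.List.Membership.Propositional.Properties using (∈-++⁺ˡ)
open import Data.List.Relation.Binary.Permutation.Propositional
  using (_↭_; ↭⇒↭ₛ; ↭-reflexive; ↭-trans; ↭-sym)
open import Data.List.Relation.Binary.Permutation.Propositional.Properties
  using (shift; ∈-resp-↭; map⁺)
open import Data.List.Relation.Binary.Permutation.Setoid.Properties using (foldr-commMonoid)
open import Data.List.Relation.Binary.Pointwise using (Pointwise; []; _∷_)
open import Data.List.Relation.Binary.Subset.Propositional using (_⊆_)
open import Data.List.Relation.Binary.Subset.Propositional.Properties using (∷⁺ʳ)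
open import Data.List.Relation.Unary.All using (All; []; _∷_)
import Data.List.Relation.Unary.All as All
open import Data.List.Relation.Unary.Any using (here; there)
open import Data.List.Relation.Unary.Unique.Propositional using (Unique; []; _∷_)
open import Data.List.Relation.Unary.Unique.Propositional.Properties using (Unique[x∷xs]⇒x∉xs)
open import Data.Maybe.Base using (just; nothing; fromMaybe)
open import Data.Nat.Base using (zero; suc; z≤n; s≤s) renaming (_≤_ to _≤ℕ_)
import Data.Nat.Properties as ℕ
open import Data.Product.Base using (_×_; _,_; proj₁; proj₂; ∃-syntax)
open import Data.Rational.Base
  using (ℚ; 0ℚ; _+_; _*_; _/_; -_; _≤_; _<_; _⊓_; nonNegative; ≢-nonZero)
import Data.Rational.Properties as ℚ
open import Data.Rational.Solver using (module +-*-Solver)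
open import Data.Sum.Base using (_⊎_; inj₁; inj₂)
open import Data.Unit.Base using (tt)
open import Function.Base using (id; _∘_; case_of_)
open import Relation.Binary.PropositionalEquality
  using (_≡_; _≢_; refl; sym; trans; cong; cong₂; subst; setoid; module ≡-Reasoning)
open import Relation.Nullary using (¬_; yes; no; contradiction)
open import Relation.Nullary.Decidable using (dec-true; dec-false)

open import Algebra.Properties.Semiring.Sum (Ring.semiring ℚ.+-*-ring)
  using (sum-cong-≗; sum-remove; sum-replicate-zero; ∑-distrib-+; *-distribˡ-sum)
  renaming (sum to ∑)
open +-*-Solver using (solve; _:+_; _:*_; _:=_; :-_; con)

two four ½ : ℚ
two  = + 2 / 1
four = + 4 / 1
½    = + 1 / 2

*-monoˡ-≤-0≤ : ∀ {r p q} → 0ℚ ≤ r → p ≤ q → r * p ≤ r * q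
*-monoˡ-≤-0≤ {r} 0≤r = ℚ.*-monoˡ-≤-nonNeg r {{nonNegative 0≤r}}

*-monoʳ-≤-0≤ : ∀ {r p q} → 0ℚ ≤ r → p ≤ q → p * r ≤ q * r
*-monoʳ-≤-0≤ {r} 0≤r = ℚ.*-monoʳ-≤-nonNeg r {{nonNegative 0≤r}}

*-nonNeg : ∀ {p q} → 0ℚ ≤ p → 0ℚ ≤ q → 0ℚ ≤ p * q
*-nonNeg {p} 0≤p 0≤q = ℚ.≤-trans (ℚ.≤-reflexive (sym (ℚ.*-zeroʳ p))) (*-monoˡ-≤-0≤ 0≤p 0≤q)

+-cancelˡ-≤ : ∀ x {y z} → x + y ≤ x + z → y ≤ z
+-cancelˡ-≤ x {y} {z} x+y≤x+z = begin
  y              ≡⟨ solve 2 (λ x y → y := (:- x) :+ (x :+ y)) refl x y ⟩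
  - x + (x + y)  ≤⟨ ℚ.+-monoʳ-≤ (- x) x+y≤x+z ⟩
  - x + (x + z)  ≡⟨ solve 2 (λ x z → (:- x) :+ (x :+ z) := z) refl x z ⟩
  z              ∎
  where open ℚ.≤-Reasoning

==⇒≡ : ∀ {m} (a b : Fin m) → (a == b) ≡ true → a ≡ b
==⇒≡ a b eq with a ≟ᶠ b
... | yes a≡b = a≡b
==⇒≡ a b () | no _

==-refl : ∀ {m} (a : Fin m) → (a == a) ≡ true
==-refl a = dec-true (a ≟ᶠ a) refl

≢⇒==-false : ∀ {m} {a b : Fin m} → a ≢ b → (a == b) ≡ false
≢⇒==-false {a = a} {b} = dec-false (a ≟ᶠ b)

elem⇒∈ : ∀ {m} {v : Fin m} xs → elem v xs ≡ true → v ∈ xs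
elem⇒∈ {v = v} (x ∷ xs) eq with v == x in v==x
... | true  = here (==⇒≡ v x v==x)
... | false = there (elem⇒∈ xs eq)

∈⇒elem : ∀ {m} {v : Fin m} {xs} → v ∈ xs → elem v xs ≡ true
∈⇒elem {v = v} (here refl) rewrite ==-refl v = refl
∈⇒elem {v = v} {x ∷ _} (there v∈xs) rewrite ∈⇒elem v∈xs with v == x
... | true  = refl
... | false = refl

∉⇒elem-false : ∀ {m} {v : Fin m} {xs} → v ∉ xs → elem v xs ≡ false
∉⇒elem-false {v = v} {xs} v∉xs with elem v xs in eq
... | true  = contradiction (elem⇒∈ xs eq) v∉xs
... | false = refl

elem-false⇒∉ : ∀ {m} {v : Fin m} {xs} → elem v xs ≡ false → v ∉ xs
elem-false⇒∉ v∉xs v∈xs = case trans (sym (∈⇒elem v∈xs)) v∉xs of λ ()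

elem-++ : ∀ {m} (v : Fin m) xs ys → elem v (xs ++ ys) ≡ elem v xs ∨ elem v ys
elem-++ v []       ys = refl
elem-++ v (x ∷ xs) ys rewrite elem-++ v xs ys with v == x
... | true  = refl
... | false = refl

sumℚ-allFin : ∀ {m} (f : Fin m → ℚ) → sumℚ (map f (allFin m)) ≡ ∑ f
sumℚ-allFin f = trans (cong sumℚ (map-tabulate id f)) (sumℚ-tabulate f)
  where
  sumℚ-tabulate : ∀ {m} (f : Fin m → ℚ) → sumℚ (tabulate f) ≡ ∑ f
  sumℚ-tabulate {zero}  f = refl
  sumℚ-tabulate {suc m} f = cong (_+_ (f zero)) (sumℚ-tabulate (f ∘ suc))

sumℚ-↭ : ∀ {xs ys} → xs ↭ ys → sumℚ xs ≡ sumℚ ys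
sumℚ-↭ p = foldr-commMonoid (setoid ℚ) ℚ.+-0-isCommutativeMonoid (↭⇒↭ₛ p)

∑-mono-≤ : ∀ {m} {f g : Fin m → ℚ} → (∀ w → f w ≤ g w) → ∑ f ≤ ∑ g
∑-mono-≤ {zero}  f≤g = ℚ.≤-refl
∑-mono-≤ {suc m} f≤g = ℚ.+-mono-≤ (f≤g zero) (∑-mono-≤ (f≤g ∘ suc))

∑-zero : ∀ {m} {f : Fin m → ℚ} → (∀ w → f w ≡ 0ℚ) → ∑ f ≡ 0ℚ
∑-zero {m} f≡0 = trans (sum-cong-≗ f≡0) (sum-replicate-zero m)

∑-nonNeg : ∀ {m} {f : Fin m → ℚ} → (∀ w → 0ℚ ≤ f w) → 0ℚ ≤ ∑ f
∑-nonNeg {m} 0≤f = ℚ.≤-trans (ℚ.≤-reflexive (sym (sum-replicate-zero m))) (∑-mono-≤ 0≤f)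

∑-single : ∀ {m} {f : Fin (suc m) → ℚ} i → (∀ j → j ≢ i → f j ≡ 0ℚ) → ∑ f ≡ f i
∑-single {m} {f} i off = begin
  ∑ f                            ≡⟨ sum-remove f ⟩
  f i + ∑ (f ∘ punchIn i)        ≡⟨ cong (_+_ (f i)) (∑-zero (λ j → off _ (punchInᵢ≢i i j))) ⟩
  f i + 0ℚ                       ≡⟨ ℚ.+-identityʳ (f i) ⟩
  f i                            ∎
  where open ≡-Reasoning

weight : ∀ {m} → (Fin m → ℚ) → (Fin m → Bool) → ℚ
weight p B = ∑ (λ w → if B w then p w else 0ℚ)

if-nonNeg : ∀ b {x} → 0ℚ ≤ x → 0ℚ ≤ (if b then x else 0ℚ)
if-nonNeg true  0≤x = 0≤x
if-nonNeg false _   = ℚ.≤-refl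

weight-nonNeg : ∀ {m} {p : Fin m → ℚ} → (∀ w → 0ℚ ≤ p w) → ∀ B → 0ℚ ≤ weight p B
weight-nonNeg 0≤p B = ∑-nonNeg (λ w → if-nonNeg (B w) (0≤p w))

weight-∷ : ∀ {m} (p : Fin m → ℚ) {x xs} → x ∉ xs →
  weight p (λ w → elem w (x ∷ xs)) ≡ p x + weight p (λ w → elem w xs)
weight-∷ {suc m} p {x} {xs} x∉xs = begin
  weight p (λ w → elem w (x ∷ xs))  ≡⟨ sum-cong-≗ split ⟩
  ∑ (λ w → atX w + inXs w)          ≡⟨ ∑-distrib-+ atX inXs ⟩
  ∑ atX + ∑ inXs                    ≡⟨ cong (_+ ∑ inXs) (∑-single x offX) ⟩
  atX x + ∑ inXs                    ≡⟨ cong (λ b → (if b then p x else 0ℚ) + ∑ inXs) (==-refl x) ⟩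
  p x + ∑ inXs                      ∎
  where
  open ≡-Reasoning
  atX inXs : Fin (suc m) → ℚ
  atX  w = if w == x then p w else 0ℚ
  inXs w = if elem w xs then p w else 0ℚ
  offX : ∀ w → w ≢ x → atX w ≡ 0ℚ
  offX w w≢x rewrite ≢⇒==-false w≢x = refl
  split : ∀ w → (if elem w (x ∷ xs) then p w else 0ℚ) ≡ atX w + inXs w
  split w with w == x in w==x
  ... | true with refl ← ==⇒≡ w x w==x rewrite ∉⇒elem-false x∉xs = sym (ℚ.+-identityʳ (p x))
  ... | false = sym (ℚ.+-identityˡ _)

sumℚ-unique : ∀ {m} (p : Fin m → ℚ) {xs} → Unique xs →
  sumℚ (map p xs) ≡ weight p (λ w → elem w xs)
sumℚ-unique {m} p [] = sym (∑-zero {m} {λ _ → 0ℚ} λ _ → refl)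
sumℚ-unique p {x ∷ xs} (u@(_ ∷ uxs)) =
  trans (cong (_+_ (p x)) (sumℚ-unique p uxs)) (sym (weight-∷ p (Unique[x∷xs]⇒x∉xs u)))

toSubset : ∀ {m} → List (Fin m) → Subset m
toSubset []       = ⊥
toSubset (x ∷ xs) = ⁅ x ⁆ ∪ toSubset xs

∈-toSubset⁻ : ∀ {m} {w : Fin m} xs → w ∈ₛ toSubset xs → w ∈ xs
∈-toSubset⁻ []       w∈ = contradiction w∈ ∉⊥
∈-toSubset⁻ (x ∷ xs) w∈ with x∈p∪q⁻ ⁅ x ⁆ (toSubset xs) w∈
... | inj₁ w∈x  = here (x∈⁅y⁆⇒x≡y x w∈x)
... | inj₂ w∈xs = there (∈-toSubset⁻ xs w∈xs)

length≤∣toSubset∣ : ∀ {m} {xs : List (Fin m)} → Unique xs → length xs ≤ℕ ∣ toSubset xs ∣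
length≤∣toSubset∣ []                          = z≤n
length≤∣toSubset∣ {xs = x ∷ xs} u@(_ ∷ uxs) =
  ℕ.≤-trans (s≤s (length≤∣toSubset∣ uxs)) (p⊂q⇒∣p∣<∣q∣ grows)
  where
  grows : toSubset xs ⊂ toSubset (x ∷ xs)
  grows = q⊆p∪q ⁅ x ⁆ (toSubset xs) , x , x∈p∪q⁺ (inj₁ (x∈⁅x⁆ x)) ,
          Unique[x∷xs]⇒x∉xs u ∘ ∈-toSubset⁻ xs

unique-length⇒∈ : ∀ {m} {xs : List (Fin m)} → Unique xs → length xs ≡ m → ∀ w → w ∈ xs
unique-length⇒∈ {m} {xs} u len w = ∈-toSubset⁻ xs (subst (w ∈ₛ_) (sym full) ∈⊤)
  where
  full : toSubset xs ≡ ⊤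
  full = ∣p∣≡n⇒p≡⊤ (ℕ.≤-antisym (∣p∣≤n (toSubset xs))
                                (subst (_≤ℕ ∣ toSubset xs ∣) len (length≤∣toSubset∣ u)))

-- Histograms

area : List (ℚ × ℚ) → ℚ
area []             = 0ℚ
area ((ℓ , q) ∷ ps) = ℓ * q + area ps

truncatedArea : ℚ → List (ℚ × ℚ) → ℚ
truncatedArea c []             = 0ℚ
truncatedArea c ((ℓ , q) ∷ ps) = ℓ * (q ⊓ c) + truncatedArea c ps

truncatedArea≤area : ∀ c {ps} → All ((0ℚ ≤_) ∘ proj₁) ps → truncatedArea c ps ≤ area ps
truncatedArea≤area c []                         = ℚ.≤-refl
truncatedArea≤area c {(ℓ , q) ∷ _} (0≤ℓ ∷ 0≤ps) =
  ℚ.+-mono-≤ (*-monoˡ-≤-0≤ 0≤ℓ (ℚ.p⊓q≤p q c)) (truncatedArea≤area c 0≤ps)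

truncatedArea-mono : ∀ {c′ c ps} → c′ ≤ c → All ((0ℚ ≤_) ∘ proj₁) ps →
  truncatedArea c′ ps ≤ truncatedArea c ps
truncatedArea-mono c′≤c []                               = ℚ.≤-refl
truncatedArea-mono {ps = (ℓ , q) ∷ _} c′≤c (0≤ℓ ∷ 0≤ps) =
  ℚ.+-mono-≤ (*-monoˡ-≤-0≤ 0≤ℓ (ℚ.⊓-monoʳ-≤ q c′≤c)) (truncatedArea-mono c′≤c 0≤ps)

truncatedArea-nonNeg : ∀ {c ps} → 0ℚ ≤ c → All (λ s → 0ℚ ≤ proj₁ s × 0ℚ ≤ proj₂ s) ps →
  0ℚ ≤ truncatedArea c ps
truncatedArea-nonNeg 0≤c []                    = ℚ.≤-refl
truncatedArea-nonNeg 0≤c ((0≤ℓ , 0≤q) ∷ 0≤ps) =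
  ℚ.+-mono-≤ (*-nonNeg 0≤ℓ (ℚ.⊓-glb 0≤q 0≤c)) (truncatedArea-nonNeg 0≤c 0≤ps)

PrefixBounded : (a μ β L : ℚ) → List (ℚ × ℚ) → Set
PrefixBounded a μ β L []             = a ≤ β * L
PrefixBounded a μ β L ((ℓ , q) ∷ ps) = a ≤ μ * q + β * L × PrefixBounded a μ β (L + ℓ) ps

truncatedArea-exchange : ∀ {a μ β c c′ K} → 0ℚ ≤ μ → 0ℚ ≤ β → 0ℚ ≤ K → c′ ≤ c →
  a ≡ two * (μ * c) → K * c ≡ K * c′ + two * β →
  ∀ {L} ps → 0ℚ ≤ L → All ((0ℚ ≤_) ∘ proj₁) ps → PrefixBounded a μ β L ps →
  a + K * truncatedArea c′ ps ≤ two * (β * L) + K * truncatedArea c ps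
truncatedArea-exchange {a} {μ} {β} {c} {c′} {K} 0≤μ 0≤β 0≤K c′≤c a≡2μc Kc≡ = go
  where
  open ℚ.≤-Reasoning

  lastBound : ∀ {L} → 0ℚ ≤ L → a ≤ β * L → a ≤ two * (β * L)
  lastBound {L} 0≤L a≤βL = begin
    a              ≤⟨ a≤βL ⟩
    β * L          ≡⟨ sym (ℚ.+-identityʳ (β * L)) ⟩
    β * L + 0ℚ     ≤⟨ ℚ.+-monoʳ-≤ (β * L) (*-nonNeg 0≤β 0≤L) ⟩
    β * L + β * L  ≡⟨ solve 1 (λ x → x :+ x := con two :* x) refl (β * L) ⟩
    two * (β * L)  ∎

  lowColumnBound : ∀ {L q} → ¬ c ≤ q → a ≤ μ * q + β * L → a ≤ two * (β * L)
  lowColumnBound {L} {q} c≰q a≤ = begin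
    a              ≡⟨ a≡2μc ⟩
    two * (μ * c)  ≤⟨ *-monoˡ-≤-0≤ (ℚ.nonNegative⁻¹ two) (+-cancelˡ-≤ (μ * c) 2μc≤μc+βL) ⟩
    two * (β * L)  ∎
    where
    2μc≤μc+βL : μ * c + μ * c ≤ μ * c + β * L
    2μc≤μc+βL = begin
      μ * c + μ * c  ≡⟨ trans (solve 1 (λ x → x :+ x := con two :* x) refl (μ * c)) (sym a≡2μc) ⟩
      a              ≤⟨ a≤ ⟩
      μ * q + β * L  ≤⟨ ℚ.+-monoˡ-≤ (β * L) (*-monoˡ-≤-0≤ 0≤μ (ℚ.<⇒≤ (ℚ.≰⇒> c≰q))) ⟩
      μ * c + β * L  ∎

  highColumn : ∀ {L ℓ q T′ T} → c ≤ q → a + K * T′ ≤ two * (β * (L + ℓ)) + K * T →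
    a + K * (ℓ * (q ⊓ c′) + T′) ≤ two * (β * L) + K * (ℓ * (q ⊓ c) + T)
  highColumn {L} {ℓ} {q} {T′} {T} c≤q rest = begin
    a + K * (ℓ * (q ⊓ c′) + T′)
      ≡⟨ cong (λ z → a + K * (ℓ * z + T′)) (ℚ.p≥q⇒p⊓q≡q (ℚ.≤-trans c′≤c c≤q)) ⟩
    a + K * (ℓ * c′ + T′)
      ≡⟨ solve 5 (λ a K ℓ c′ T′ → a :+ K :* (ℓ :* c′ :+ T′) := (a :+ K :* T′) :+ ℓ :* (K :* c′))
               refl a K ℓ c′ T′ ⟩
    (a + K * T′) + ℓ * (K * c′)
      ≤⟨ ℚ.+-monoˡ-≤ (ℓ * (K * c′)) rest ⟩
    (two * (β * (L + ℓ)) + K * T) + ℓ * (K * c′)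
      ≡⟨ solve 6 (λ β L ℓ K T Kc′ → (con two :* (β :* (L :+ ℓ)) :+ K :* T) :+ ℓ :* Kc′
                                   := con two :* (β :* L) :+ (K :* T :+ ℓ :* (Kc′ :+ con two :* β)))
               refl β L ℓ K T (K * c′) ⟩
    two * (β * L) + (K * T + ℓ * (K * c′ + two * β))
      ≡⟨ cong (λ z → two * (β * L) + (K * T + ℓ * z)) (sym Kc≡) ⟩
    two * (β * L) + (K * T + ℓ * (K * c))
      ≡⟨ solve 5 (λ βL K T ℓ c → βL :+ (K :* T :+ ℓ :* (K :* c)) := βL :+ K :* (ℓ :* c :+ T))
               refl (two * (β * L)) K T ℓ c ⟩
    two * (β * L) + K * (ℓ * c + T)
      ≡⟨ cong (λ z → two * (β * L) + K * (ℓ * z + T)) (sym (ℚ.p≥q⇒p⊓q≡q c≤q)) ⟩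
    two * (β * L) + K * (ℓ * (q ⊓ c) + T) ∎

  go : ∀ {L} ps → 0ℚ ≤ L → All ((0ℚ ≤_) ∘ proj₁) ps → PrefixBounded a μ β L ps →
       a + K * truncatedArea c′ ps ≤ two * (β * L) + K * truncatedArea c ps
  go [] 0≤L [] a≤βL = ℚ.+-monoˡ-≤ (K * 0ℚ) (lastBound 0≤L a≤βL)
  go ((ℓ , q) ∷ ps) 0≤L (0≤ℓ ∷ 0≤ps) (a≤ , bounded) with c ℚ.≤? q
  ... | yes c≤q = highColumn c≤q (go ps (ℚ.+-mono-≤ 0≤L 0≤ℓ) 0≤ps bounded)
  ... | no c≰q  = ℚ.+-mono-≤ (lowColumnBound c≰q a≤)
    (*-monoˡ-≤-0≤ 0≤K (truncatedArea-mono {ps = (ℓ , q) ∷ ps} c′≤c (0≤ℓ ∷ 0≤ps)))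

lenE-nonNeg : ∀ {m} {I : Instance m} → WellFormed I → ∀ e → 0ℚ ≤ lenE I e
lenE-nonNeg {I = I} (_ , _ , _ , edge , _) (u , v) with len I u v in uv
... | nothing = ℚ.≤-refl
... | just ℓ  = ℚ.<⇒≤ (proj₂ (proj₂ (edge u v ℓ uv)))

module _ {m} {I : Instance m} (0≤len : ∀ e → 0ℚ ≤ lenE I e) where

  treeLen-nonNeg : ∀ σ → 0ℚ ≤ treeLen I σ
  treeLen-nonNeg []      = ℚ.≤-refl
  treeLen-nonNeg (e ∷ σ) = ℚ.+-mono-≤ (0≤len e) (treeLen-nonNeg σ)

  arr-nonNeg : ∀ v σ → 0ℚ ≤ arr I v σ
  arr-nonNeg v []            = ℚ.≤-refl
  arr-nonNeg v ((a , b) ∷ σ) with (v == a) ∨ (v == b)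
  ... | true  = ℚ.+-mono-≤ (0≤len (a , b)) ℚ.≤-refl
  ... | false = ℚ.+-mono-≤ (0≤len (a , b)) (arr-nonNeg v σ)

  arr-++ : ∀ v ρ τ → arr I v (ρ ++ τ) ≤ treeLen I ρ + arr I v τ
  arr-++ v []            τ = ℚ.≤-reflexive (sym (ℚ.+-identityˡ _))
  arr-++ v ((a , b) ∷ ρ) τ = ℚ.≤-trans (ℚ.+-monoʳ-≤ (lenE I (a , b)) later)
    (ℚ.≤-reflexive (sym (ℚ.+-assoc (lenE I (a , b)) (treeLen I ρ) (arr I v τ))))
    where
    later : (if (v == a) ∨ (v == b) then 0ℚ else arr I v (ρ ++ τ)) ≤ treeLen I ρ + arr I v τ
    later with (v == a) ∨ (v == b)
    ... | true  = ℚ.+-mono-≤ (treeLen-nonNeg ρ) (arr-nonNeg v τ)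
    ... | false = arr-++ v ρ τ

  arr-++-reached : ∀ v ρ τ → v ∈ map proj₂ ρ → arr I v (ρ ++ τ) ≤ treeLen I ρ
  arr-++-reached v ((a , b) ∷ ρ) τ v∈ρ with (v == a) ∨ (v == b) in hit
  ... | true = ℚ.+-monoʳ-≤ (lenE I (a , b)) (treeLen-nonNeg ρ)
  arr-++-reached v ((a , b) ∷ ρ) τ (here refl) | false
    rewrite ==-refl v | ∨-zeroʳ (v == a) = case hit of λ ()
  arr-++-reached v ((a , b) ∷ ρ) τ (there v∈ρ) | false =
    ℚ.+-monoʳ-≤ (lenE I (a , b)) (arr-++-reached v ρ τ v∈ρ)

treeLen≡0⇒[] : ∀ {m} {I : Instance m} → WellFormed I → ∀ {vs T} → ValidSeq I vs T →
  treeLen I T ≡ 0ℚ → T ≡ []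
treeLen≡0⇒[] wf {T = []} _ _ = refl
treeLen≡0⇒[] {I = I} wf@(_ , _ , _ , edge , _) {T = (u , v) ∷ T} (_ , _ , (ℓ , uv) , _) len≡0 =
  contradiction (sym len≡0) (ℚ.<⇒≢ (ℚ.<-≤-trans 0<ℓ ℓ≤len))
  where
  0<ℓ : 0ℚ < ℓ
  0<ℓ = proj₂ (proj₂ (edge u v ℓ uv))
  ℓ≤len : ℓ ≤ treeLen I ((u , v) ∷ T)
  ℓ≤len rewrite uv = ℚ.≤-trans (ℚ.≤-reflexive (sym (ℚ.+-identityʳ ℓ)))
                                (ℚ.+-monoʳ-≤ ℓ (treeLen-nonNeg {I = I} (lenE-nonNeg wf) T))

prefix-valid : ∀ {m} {I : Instance m} {vs} pre {rest} →
  ValidSeq I vs (pre ++ rest) → ValidSeq I vs pre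
prefix-valid []              _                   = tt
prefix-valid ((_ , v) ∷ pre) (u∈ , v∉ , uv , vσ) = u∈ , v∉ , uv , prefix-valid pre vσ

visited : ∀ {m} → List (Fin m) → List (Edge m) → List (Fin m)
visited vs []            = vs
visited vs ((_ , v) ∷ σ) = visited (v ∷ vs) σ

++↭visited : ∀ {m} (vs : List (Fin m)) σ → vs ++ map proj₂ σ ↭ visited vs σ
++↭visited vs []            = ↭-reflexive (++-identityʳ vs)
++↭visited vs ((_ , v) ∷ σ) = ↭-trans (shift v vs (map proj₂ σ)) (++↭visited (v ∷ vs) σ)

module _ {m} (I : Instance m) where

  newVertices-unique : ∀ {vs σ} → ValidSeq I vs σ →
    Unique (map proj₂ σ) × All (_∉ vs) (map proj₂ σ)
  newVertices-unique {σ = []}          _                   = [] , []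
  newVertices-unique {σ = (_ , v) ∷ σ} (_ , v∉vs , _ , vσ) with newVertices-unique vσ
  ... | uσ , fresh = All.map (λ w∉ v≡w → w∉ (here (sym v≡w))) fresh ∷ uσ ,
                     v∉vs ∷ All.map (λ w∉ w∈ → w∉ (there w∈)) fresh

  treeVerts-unique : ∀ {T} → IsSubtree I T → Unique (treeVerts I T)
  treeVerts-unique vT with newVertices-unique vT
  ... | uT , fresh = All.map (λ w∉ r≡w → w∉ (here (sym r≡w))) fresh ∷ uT

  treeProb≡weight : prob I (root I) ≡ 0ℚ → ∀ {T} → IsSubtree I T →
    treeProb I T ≡ weight (prob I) (λ w → elem w (map proj₂ T))
  treeProb≡weight p₀≡0 vT rewrite p₀≡0 =
    trans (ℚ.+-identityˡ _) (sumℚ-unique (prob I) (proj₁ (newVertices-unique vT)))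

  unvisitedMass : List (Fin m) → ℚ
  unvisitedMass vs = weight (prob I) (λ w → not (elem w vs))

  unvisitedMass-all : ∀ {vs} → (∀ w → w ∈ vs) → unvisitedMass vs ≡ 0ℚ
  unvisitedMass-all {vs} all∈ = ∑-zero none
    where
    none : ∀ w → (if not (elem w vs) then prob I w else 0ℚ) ≡ 0ℚ
    none w rewrite ∈⇒elem (all∈ w) = refl

  unvisitedMass-++ : ∀ S {xs} → (∀ {v} → v ∈ xs → elem v S ≡ false) →
    unvisitedMass S ≡ unvisitedMass (S ++ xs) + weight (prob I) (λ w → elem w xs)
  unvisitedMass-++ S {xs} disjoint = trans (sum-cong-≗ split) (∑-distrib-+ outside inside)
    where
    outside inside : Fin m → ℚ
    outside w = if not (elem w (S ++ xs)) then prob I w else 0ℚ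
    inside  w = if elem w xs then prob I w else 0ℚ
    split : ∀ w → (if not (elem w S) then prob I w else 0ℚ) ≡ outside w + inside w
    split w rewrite elem-++ w S xs with elem w S in wS | elem w xs in wxs
    ... | true  | true  = case trans (sym wS) (disjoint (elem⇒∈ xs wxs)) of λ ()
    ... | true  | false = sym (ℚ.+-identityʳ 0ℚ)
    ... | false | true  = sym (ℚ.+-identityˡ (prob I w))
    ... | false | false = sym (ℚ.+-identityʳ (prob I w))

  histogram : List (Fin m) → List (Edge m) → List (ℚ × ℚ)
  histogram vs []              = []
  histogram vs (e@(_ , v) ∷ σ) = (lenE I e , unvisitedMass vs) ∷ histogram (v ∷ vs) σ

  unvisitedCost : List (Fin m) → List (Edge m) → ℚ
  unvisitedCost vs σ = weight (λ w → prob I w * arr I w σ) (λ w → not (elem w vs))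

  cost≡unvisitedCost : ∀ σ → cost I σ ≡ unvisitedCost (root I ∷ []) σ
  cost≡unvisitedCost σ =
    trans (sumℚ-allFin {m} (λ w → prob I w * arrival I w σ)) (sum-cong-≗ atRoot)
    where
    atRoot : ∀ w → prob I w * arrival I w σ
                 ≡ (if not (elem w (root I ∷ [])) then prob I w * arr I w σ else 0ℚ)
    atRoot w with w == root I
    ... | true  = ℚ.*-zeroʳ (prob I w)
    ... | false = refl

  unvisitedCost≡area : ∀ {vs σ} → ValidSeq I vs σ → unvisitedCost vs σ ≡ area (histogram vs σ)
  unvisitedCost≡area {vs} {[]} _ = ∑-zero noCost
    where
    noCost : ∀ w → (if not (elem w vs) then prob I w * 0ℚ else 0ℚ) ≡ 0ℚ
    noCost w with elem w vs
    ... | true  = refl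
    ... | false = ℚ.*-zeroʳ (prob I w)
  unvisitedCost≡area {vs} {(u , v) ∷ σ} (u∈vs , _ , _ , vσ) = begin
    unvisitedCost vs ((u , v) ∷ σ)
      ≡⟨ sum-cong-≗ split ⟩
    ∑ (λ w → ℓ * mass w + rest w)
      ≡⟨ ∑-distrib-+ (λ w → ℓ * mass w) rest ⟩
    ∑ (λ w → ℓ * mass w) + unvisitedCost (v ∷ vs) σ
      ≡⟨ cong₂ _+_ (sym (*-distribˡ-sum ℓ mass)) (unvisitedCost≡area vσ) ⟩
    ℓ * unvisitedMass vs + area (histogram (v ∷ vs) σ) ∎
    where
    open ≡-Reasoning
    ℓ : ℚ
    ℓ = lenE I (u , v)
    mass rest : Fin m → ℚ
    mass w = if not (elem w vs) then prob I w else 0ℚ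
    rest w = if not (elem w (v ∷ vs)) then prob I w * arr I w σ else 0ℚ
    split : ∀ w → (if not (elem w vs) then prob I w * arr I w ((u , v) ∷ σ) else 0ℚ)
                ≡ ℓ * mass w + rest w
    split w with elem w vs in wvs | w == u in w==u | w == v
    ... | true  | _     | b rewrite ∨-zeroʳ b = sym (trans (ℚ.+-identityʳ _) (ℚ.*-zeroʳ ℓ))
    ... | false | true  | _ =
      contradiction (subst (_∈ vs) (sym (==⇒≡ w u w==u)) u∈vs) (elem-false⇒∉ wvs)
    ... | false | false | true  =
      solve 2 (λ p ℓ → p :* (ℓ :+ con 0ℚ) := ℓ :* p :+ con 0ℚ) refl (prob I w) ℓ
    ... | false | false | false =
      solve 3 (λ p ℓ a → p :* (ℓ :+ a) := ℓ :* p :+ p :* a) refl (prob I w) ℓ (arr I w σ)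

  histogram-nonNeg : (∀ e → 0ℚ ≤ lenE I e) → (∀ w → 0ℚ ≤ prob I w) →
    ∀ vs σ → All (λ s → 0ℚ ≤ proj₁ s × 0ℚ ≤ proj₂ s) (histogram vs σ)
  histogram-nonNeg 0≤len 0≤p vs []              = []
  histogram-nonNeg 0≤len 0≤p vs (e@(_ , v) ∷ σ) =
    (0≤len e , weight-nonNeg 0≤p _) ∷ histogram-nonNeg 0≤len 0≤p (v ∷ vs) σ

  histogram-prefixBounded : ∀ {a μ β} vs L σ →
    (∀ pre rest → pre ++ rest ≡ σ →
       a ≤ μ * unvisitedMass (visited vs pre) + β * (L + treeLen I pre)) →
    unvisitedMass (visited vs σ) ≡ 0ℚ →
    PrefixBounded a μ β L (histogram vs σ)
  histogram-prefixBounded {a} {μ} {β} vs L [] bound none = begin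
    a                                    ≤⟨ bound [] [] refl ⟩
    μ * unvisitedMass vs + β * (L + 0ℚ)  ≡⟨ cong₂ (λ x y → μ * x + β * y) none (ℚ.+-identityʳ L) ⟩
    μ * 0ℚ + β * L                       ≡⟨ solve 3 (λ μ β L → μ :* con 0ℚ :+ β :* L := β :* L)
                                                  refl μ β L ⟩
    β * L                                ∎
    where open ℚ.≤-Reasoning
  histogram-prefixBounded {a} {μ} {β} vs L (e@(_ , v) ∷ σ) bound none =
    ℚ.≤-trans (bound [] (e ∷ σ) refl)
      (ℚ.≤-reflexive (cong (λ y → μ * unvisitedMass vs + β * y) (ℚ.+-identityʳ L))) ,
    histogram-prefixBounded (v ∷ vs) (L + lenE I e) σ bound′ none
    where
    bound′ : ∀ pre rest → pre ++ rest ≡ σ →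
      a ≤ μ * unvisitedMass (visited (v ∷ vs) pre) + β * ((L + lenE I e) + treeLen I pre)
    bound′ pre rest pre++rest≡σ rewrite ℚ.+-assoc L (lenE I e) (treeLen I pre) =
      bound (e ∷ pre) rest (cong (e ∷_) pre++rest≡σ)

-- Contraction

minLen-attained : ∀ {m} (G : Instance m) S {w ℓ} → minLen G S w ≡ just ℓ →
  ∃[ s ] (s ∈ S × len G s w ≡ just ℓ)
minLen-attained G (s ∷ S) {w} eq with len G s w in sw | minLen G S w in Sw
... | nothing | nothing = case eq of λ ()
... | nothing | just b with refl ← eq with t , t∈S , tw ← minLen-attained G S Sw =
  t , there t∈S , tw
... | just a  | nothing with refl ← eq = s , here refl , sw
... | just a  | just b with refl ← eq | ℚ.⊓-sel a b
...   | inj₁ a⊓b≡a = s , here refl , trans sw (cong just (sym a⊓b≡a))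
...   | inj₂ a⊓b≡b with t , t∈S , tw ← minLen-attained G S Sw =
  t , there t∈S , trans tw (cong just (sym a⊓b≡b))

minLen-≤ : ∀ {m} (G : Instance m) {s w ℓ} S → s ∈ S → len G s w ≡ just ℓ →
  ∃[ ℓ′ ] (minLen G S w ≡ just ℓ′ × ℓ′ ≤ ℓ)
minLen-≤ G {s} {w} {ℓ} (_ ∷ S) (here refl) sw rewrite sw with minLen G S w
... | nothing = ℓ , refl , ℚ.≤-refl
... | just b  = ℓ ⊓ b , refl , ℚ.p⊓q≤p ℓ b
minLen-≤ G {s} {w} (t ∷ S) (there s∈S) sw with minLen-≤ G S s∈S sw
... | ℓ′ , Sw , ℓ′≤ℓ rewrite Sw with len G t w
...   | nothing = ℓ′ , refl , ℓ′≤ℓ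
...   | just a  = a ⊓ ℓ′ , refl , ℚ.≤-trans (ℚ.p⊓q≤q a ℓ′) ℓ′≤ℓ

module Contraction {m} (G : Instance m) (S : List (Fin m)) where

  C : Instance m
  C = contract G S

  data ContractedEdge : Fin m → Fin m → ℚ → Set where
    fromRoot : ∀ {w ℓ} → elem w S ≡ false → minLen G S w ≡ just ℓ → ContractedEdge (root G) w ℓ
    toRoot   : ∀ {u ℓ} → elem u S ≡ false → minLen G S u ≡ just ℓ → ContractedEdge u (root G) ℓ
    inside   : ∀ {u v ℓ} → elem u S ≡ false → elem v S ≡ false → len G u v ≡ just ℓ →
               ContractedEdge u v ℓ

  contractedEdge : ∀ {u v ℓ} → len C u v ≡ just ℓ → ContractedEdge u v ℓ
  contractedEdge {u} {v} eq
    with elem u S in uS | elem v S in vS | u == root G in u==r | v == root G in v==r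
  ... | true  | true  | true  | _ = case eq of λ ()
  ... | true  | true  | false | _ = case eq of λ ()
  ... | true  | false | true  | _ with refl ← ==⇒≡ u (root G) u==r = fromRoot vS eq
  ... | true  | false | false | _ = case eq of λ ()
  ... | false | true  | _ | true  with refl ← ==⇒≡ v (root G) v==r = toRoot uS eq
  ... | false | true  | _ | false = case eq of λ ()
  ... | false | false | _ | _ = inside uS vS eq

  len-contract-root : root G ∈ S → ∀ {w} → elem w S ≡ false → len C (root G) w ≡ minLen G S w
  len-contract-root r∈S w∉S rewrite ∈⇒elem r∈S | w∉S | ==-refl (root G) = refl

  len-contract-inside : ∀ {u v} → elem u S ≡ false → elem v S ≡ false → len C u v ≡ len G u v
  len-contract-inside u∉S v∉S rewrite u∉S | v∉S = refl

  vert-contract⁻ : ∀ {v} → vert C v ≡ true → v ≡ root G ⊎ (vert G v ≡ true × elem v S ≡ false)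
  vert-contract⁻ {v} vC with v == root G in v==r | vert G v | elem v S
  ... | true  | _     | _     = inj₁ (==⇒≡ v (root G) v==r)
  ... | false | true  | false = inj₂ (refl , refl)
  ... | false | true  | true  = case vC of λ ()
  ... | false | false | _     = case vC of λ ()

  vert-contract-root : vert C (root G) ≡ true
  vert-contract-root rewrite ==-refl (root G) = refl

  vert-contract-outside : ∀ {v} → vert G v ≡ true → elem v S ≡ false → vert C v ≡ true
  vert-contract-outside {v} vG v∉S rewrite vG | v∉S = ∨-zeroʳ (v == root G)

  reach-contract : root G ∈ S → ∀ {v} → Reach G v → elem v S ≡ false → Reach C v
  reach-contract r∈S here r∉S = case trans (sym (∈⇒elem r∈S)) r∉S of λ ()
  reach-contract r∈S (step {u} {v} reach-u (ℓ , uv)) v∉S with elem u S in uS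
  ... | true with ℓ′ , Sv , _ ← minLen-≤ G S (elem⇒∈ S uS) uv =
    step here (ℓ′ , trans (len-contract-root r∈S v∉S) Sv)
  ... | false = step (reach-contract r∈S reach-u uS) (ℓ , trans (len-contract-inside uS v∉S) uv)

  contract-wellFormed : WellFormed G → root G ∈ S → WellFormed C
  contract-wellFormed (rootV , symG , irrG , edgeG , probG , reachG) r∈S =
    vert-contract-root , symmetric , irreflexive , edges , probs , reach
    where
    symmetric : ∀ u v → len C u v ≡ len C v u
    symmetric u v with elem u S | elem v S | u == root G | v == root G
    ... | true  | true  | a | b rewrite ∧-zeroʳ a | ∧-zeroʳ b = refl
    ... | true  | false | a | _ rewrite ∧-identityʳ a = refl
    ... | false | true  | _ | b rewrite ∧-identityʳ b = refl
    ... | false | false | _ | _ = symG u v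

    irreflexive : ∀ v → len C v v ≡ nothing
    irreflexive v with elem v S | v == root G
    ... | true  | a rewrite ∧-zeroʳ a = refl
    ... | false | _ = irrG v

    outsideEdge : ∀ {u v ℓ} → elem u S ≡ false → elem v S ≡ false → len G u v ≡ just ℓ →
                  (vert C u ≡ true) × (vert C v ≡ true) × (0ℚ < ℓ)
    outsideEdge {u} {v} {ℓ} u∉S v∉S uv with uG , vG , 0<ℓ ← edgeG u v ℓ uv =
      vert-contract-outside uG u∉S , vert-contract-outside vG v∉S , 0<ℓ

    fromRootEdge : ∀ {w ℓ} → elem w S ≡ false → minLen G S w ≡ just ℓ →
                   (vert C w ≡ true) × (0ℚ < ℓ)
    fromRootEdge {w} {ℓ} w∉S Sw with s , _ , sw ← minLen-attained G S Sw
                                 with _ , wG , 0<ℓ ← edgeG s w ℓ sw =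
      vert-contract-outside wG w∉S , 0<ℓ

    edges : ∀ u v ℓ → len C u v ≡ just ℓ → (vert C u ≡ true) × (vert C v ≡ true) × (0ℚ < ℓ)
    edges u v ℓ uv with contractedEdge uv
    ... | fromRoot w∉S Sw with wC , 0<ℓ ← fromRootEdge w∉S Sw = vert-contract-root , wC , 0<ℓ
    ... | toRoot u∉S Su   with uC , 0<ℓ ← fromRootEdge u∉S Su = uC , vert-contract-root , 0<ℓ
    ... | inside u∉S v∉S uvG = outsideEdge u∉S v∉S uvG

    probs : ∀ v → vert C v ≡ true → 0ℚ ≤ prob C v
    probs v vC with vert-contract⁻ vC
    ... | inj₁ refl     = probG (root G) rootV
    ... | inj₂ (vG , _) = probG v vG

    reach : ∀ v → vert C v ≡ true → Reach C v
    reach v vC with vert-contract⁻ vC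
    ... | inj₁ refl         = here
    ... | inj₂ (vG , v∉S) = reach-contract r∈S (reachG v vG) v∉S

  newVertex-outside : ∀ {x y ℓ} → y ≢ root G → len C x y ≡ just ℓ → elem y S ≡ false
  newVertex-outside y≢r xy with contractedEdge xy
  ... | fromRoot y∉S _ = y∉S
  ... | toRoot _ _     = contradiction refl y≢r
  ... | inside _ y∉S _ = y∉S

  newVertices-outside : ∀ {vs T} → root G ∈ vs → ValidSeq C vs T →
    ∀ {v} → v ∈ map proj₂ T → elem v S ≡ false
  newVertices-outside {T = (_ , y) ∷ T} r∈vs (_ , y∉vs , (_ , xy) , vT) (here refl) =
    newVertex-outside (λ y≡r → y∉vs (subst (_∈ _) (sym y≡r) r∈vs)) xy
  newVertices-outside {T = _ ∷ T} r∈vs (_ , _ , _ , vT) (there v∈T) =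
    newVertices-outside (there r∈vs) vT v∈T

  lift-lenE : root G ∈ S → ∀ {x y ℓ e} → y ≢ root G → len C x y ≡ just ℓ →
    LiftE G S (x , y) e → lenE G e ≡ ℓ
  lift-lenE r∈S y≢r xy (rootEdge _ sw≡Sw) with contractedEdge xy
  ... | fromRoot _ Sw rewrite sw≡Sw | Sw = refl
  ... | toRoot _ _    = contradiction refl y≢r
  ... | inside r∉S _ _ = case trans (sym (∈⇒elem r∈S)) r∉S of λ ()
  lift-lenE r∈S y≢r xy (keep x≢r) with contractedEdge xy
  ... | fromRoot _ _  = contradiction refl x≢r
  ... | toRoot _ _    = contradiction refl y≢r
  ... | inside _ _ uv = cong (fromMaybe 0ℚ) uv

  lift-treeLen : root G ∈ S → ∀ {vs σ ρ} → root G ∈ vs → ValidSeq C vs σ →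
    Pointwise (LiftE G S) σ ρ → treeLen G ρ ≡ treeLen C σ
  lift-treeLen r∈S r∈vs _ [] = refl
  lift-treeLen r∈S {vs} {(_ , y) ∷ _} r∈vs (_ , y∉vs , (_ , xy) , vσ) (lifted ∷ ρ) =
    cong₂ _+_ (trans (lift-lenE r∈S y≢r xy lifted) (sym (cong (fromMaybe 0ℚ) xy)))
              (lift-treeLen r∈S (there r∈vs) vσ ρ)
    where
    y≢r : y ≢ root G
    y≢r y≡r = y∉vs (subst (_∈ vs) (sym y≡r) r∈vs)

  lift-newVertices : ∀ {σ ρ} → Pointwise (LiftE G S) σ ρ → map proj₂ σ ≡ map proj₂ ρ
  lift-newVertices []                 = refl
  lift-newVertices (rootEdge _ _ ∷ ρ) = cong (_ ∷_) (lift-newVertices ρ)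
  lift-newVertices (keep _ ∷ ρ)       = cong (_ ∷_) (lift-newVertices ρ)

  contractSeq : List (Edge m) → List (Edge m)
  contractSeq []            = []
  contractSeq ((u , v) ∷ σ) =
    if elem v S then contractSeq σ else ((if elem u S then root G else u) , v) ∷ contractSeq σ

  Tracks : List (Fin m) → List (Fin m) → Set
  Tracks vsG vsC = ∀ {w} → w ∈ vsG → elem w S ≡ false → w ∈ vsC

  tracks-skip : ∀ {v vsG vsC} → elem v S ≡ true → Tracks vsG vsC → Tracks (v ∷ vsG) vsC
  tracks-skip vS tracks (here refl) w∉S = case trans (sym vS) w∉S of λ ()
  tracks-skip vS tracks (there w∈)  w∉S = tracks w∈ w∉S

  tracks-keep : ∀ {v vsG vsC} → Tracks vsG vsC → Tracks (v ∷ vsG) (v ∷ vsC)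
  tracks-keep tracks (here refl) _   = here refl
  tracks-keep tracks (there w∈)  w∉S = there (tracks w∈ w∉S)

  contractSeq-visits : ∀ {vsG vsC} σ → Tracks vsG vsC →
    Tracks (visited vsG σ) (visited vsC (contractSeq σ))
  contractSeq-visits []            tracks = tracks
  contractSeq-visits ((u , v) ∷ σ) tracks with elem v S in vS
  ... | true  = contractSeq-visits σ (tracks-skip vS tracks)
  ... | false = contractSeq-visits σ (tracks-keep tracks)

  contractSeq-valid : root G ∈ S → ∀ {vsG vsC σ} → ValidSeq G vsG σ →
    vsC ⊆ vsG → Tracks vsG vsC → root G ∈ vsC → ValidSeq C vsC (contractSeq σ)
  contractSeq-valid r∈S {σ = []} _ _ _ _ = tt
  contractSeq-valid r∈S {vsG} {vsC} {(u , v) ∷ σ} (u∈G , v∉G , (ℓ , uv) , vσ) C⊆G tracks r∈C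
    with elem v S in vS
  ... | true  = contractSeq-valid r∈S vσ (there ∘ C⊆G) (tracks-skip vS tracks) r∈C
  ... | false = source∈C , v∉G ∘ C⊆G , edge ,
                contractSeq-valid r∈S vσ (∷⁺ʳ v C⊆G) (tracks-keep tracks) (there r∈C)
    where
    source∈C : (if elem u S then root G else u) ∈ vsC
    source∈C with elem u S in uS
    ... | true  = r∈C
    ... | false = tracks u∈G uS
    edge : Is-just (len C (if elem u S then root G else u) v)
    edge with elem u S in uS
    ... | true with ℓ′ , Sv , _ ← minLen-≤ G S (elem⇒∈ S uS) uv =
      ℓ′ , trans (len-contract-root r∈S vS) Sv
    ... | false = ℓ , trans (len-contract-inside uS vS) uv

  contractSeq-treeLen : root G ∈ S → (∀ e → 0ℚ ≤ lenE G e) → ∀ {vs σ} → ValidSeq G vs σ →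
    treeLen C (contractSeq σ) ≤ treeLen G σ
  contractSeq-treeLen r∈S 0≤len {σ = []} _ = ℚ.≤-refl
  contractSeq-treeLen r∈S 0≤len {σ = (u , v) ∷ σ} (_ , _ , (ℓ , uv) , vσ)
    with elem v S in vS
  ... | true = ℚ.≤-trans (contractSeq-treeLen r∈S 0≤len vσ)
    (ℚ.≤-trans (ℚ.≤-reflexive (sym (ℚ.+-identityˡ _))) (ℚ.+-monoˡ-≤ (treeLen G σ) (0≤len (u , v))))
  ... | false = ℚ.+-mono-≤ edge (contractSeq-treeLen r∈S 0≤len vσ)
    where
    edge : lenE C ((if elem u S then root G else u) , v) ≤ lenE G (u , v)
    edge with elem u S in uS
    ... | true with ℓ′ , Sv , ℓ′≤ℓ ← minLen-≤ G S (elem⇒∈ S uS) uv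
      rewrite len-contract-root r∈S vS | Sv | uv = ℓ′≤ℓ
    ... | false = ℚ.≤-reflexive (cong (fromMaybe 0ℚ) (len-contract-inside uS vS))

-- The greedy algorithm

module Greedy {m} (A : MDSPAlg) (G : Instance m) (wf : WellFormed G)
                (0≤p : ∀ w → 0ℚ ≤ prob G w) where

  tree : List (Fin m) → List (Edge m)
  tree S = A (contract G S)

  treeLength : List (Fin m) → ℚ
  treeLength S = treeLen (contract G S) (tree S)

  grow : List (Fin m) → List (Fin m)
  grow S = S ++ map proj₂ (tree S)

  0≤len : ∀ e → 0ℚ ≤ lenE G e
  0≤len = lenE-nonNeg wf

  iteration-cost-≤ : ∀ {S σ ρ τ} → root G ∈ S → σ ↭ tree S →
    ValidSeq (contract G S) (root G ∷ []) σ → Pointwise (LiftE G S) σ ρ →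
    unvisitedCost G S (ρ ++ τ) ≤ treeLength S * unvisitedMass G S + unvisitedCost G (grow S) τ
  iteration-cost-≤ {S} {σ} {ρ} {τ} r∈S σ↭T vσ lifts = begin
    unvisitedCost G S (ρ ++ τ)                     ≤⟨ ∑-mono-≤ pointwise ⟩
    ∑ (λ w → λT * mass w + later w)                ≡⟨ ∑-distrib-+ (λ w → λT * mass w) later ⟩
    ∑ (λ w → λT * mass w) + unvisitedCost G S′ τ   ≡⟨ cong (_+ unvisitedCost G S′ τ)
                                                          (sym (*-distribˡ-sum λT mass)) ⟩
    λT * unvisitedMass G S + unvisitedCost G S′ τ  ∎
    where
    open ℚ.≤-Reasoning
    open Contraction G S using (lift-treeLen; lift-newVertices)
    λT : ℚ
    λT = treeLength S
    S′ : List (Fin m)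
    S′ = grow S
    mass later : Fin m → ℚ
    mass w  = if not (elem w S) then prob G w else 0ℚ
    later w = if not (elem w S′) then prob G w * arr G w τ else 0ℚ

    ρ-length : treeLen G ρ ≡ λT
    ρ-length = trans (lift-treeLen r∈S (here refl) vσ lifts)
                     (sumℚ-↭ (map⁺ (lenE (contract G S)) σ↭T))

    reached : ∀ {w} → w ∈ map proj₂ (tree S) → w ∈ map proj₂ ρ
    reached w∈T = subst (_ ∈_) (lift-newVertices lifts) (∈-resp-↭ (↭-sym (map⁺ proj₂ σ↭T)) w∈T)

    pointwise : ∀ w → (if not (elem w S) then prob G w * arr G w (ρ ++ τ) else 0ℚ)
                    ≤ λT * mass w + later w
    pointwise w rewrite elem-++ w S (map proj₂ (tree S))
      with elem w S | elem w (map proj₂ (tree S)) in wT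
    ... | true  | _    = ℚ.≤-reflexive (sym (trans (ℚ.+-identityʳ _) (ℚ.*-zeroʳ λT)))
    ... | false | true = begin
      prob G w * arr G w (ρ ++ τ)  ≤⟨ *-monoˡ-≤-0≤ (0≤p w)
                                        (arr-++-reached 0≤len w ρ τ (reached (elem⇒∈ _ wT))) ⟩
      prob G w * treeLen G ρ       ≡⟨ cong (prob G w *_) ρ-length ⟩
      prob G w * λT                ≡⟨ solve 2 (λ p t → p :* t := t :* p :+ con 0ℚ) refl (prob G w) λT ⟩
      λT * prob G w + 0ℚ           ∎
    ... | false | false = begin
      prob G w * arr G w (ρ ++ τ)           ≤⟨ *-monoˡ-≤-0≤ (0≤p w) (arr-++ 0≤len w ρ τ) ⟩
      prob G w * (treeLen G ρ + arr G w τ)  ≡⟨ cong (λ t → prob G w * (t + arr G w τ)) ρ-length ⟩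
      prob G w * (λT + arr G w τ)           ≡⟨ solve 3 (λ p t a → p :* (t :+ a) := t :* p :+ p :* a)
                                                      refl (prob G w) λT (arr G w τ) ⟩
      λT * prob G w + prob G w * arr G w τ  ∎

  greedy-cost-≤ : (Φ : List (Fin m) → ℚ) → (∀ S → 0ℚ ≤ Φ S) →
    (∀ S → root G ∈ S → treeLength S * unvisitedMass G S + Φ (grow S) ≤ Φ S) →
    ∀ {S τ} → GreedyRun A G S τ → root G ∈ S → unvisitedCost G S τ ≤ Φ S
  greedy-cost-≤ Φ 0≤Φ decrease {S} {τ} (done nonePositive _ _) r∈S =
    ℚ.≤-trans (ℚ.≤-reflexive (∑-zero noCost)) (0≤Φ S)
    where
    noCost : ∀ w → (if not (elem w S) then prob G w * arr G w τ else 0ℚ) ≡ 0ℚ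
    noCost w with elem w S in wS
    ... | true  = refl
    ... | false rewrite ℚ.≤-antisym (ℚ.≮⇒≥ (nonePositive w (elem-false⇒∉ wS))) (0≤p w) =
      ℚ.*-zeroˡ (arr G w τ)
  greedy-cost-≤ Φ 0≤Φ decrease {S} (iter {ρ = ρ} {rest} _ σ↭T vσ lifts run) r∈S = begin
    unvisitedCost G S (ρ ++ rest)                                ≤⟨ iteration-cost-≤ r∈S σ↭T vσ lifts ⟩
    treeLength S * unvisitedMass G S + unvisitedCost G (grow S) rest
      ≤⟨ ℚ.+-monoʳ-≤ (treeLength S * unvisitedMass G S)
                     (greedy-cost-≤ Φ 0≤Φ decrease run (∈-++⁺ˡ r∈S)) ⟩
    treeLength S * unvisitedMass G S + Φ (grow S)                ≤⟨ decrease S r∈S ⟩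
    Φ S                                                          ∎
    where open ℚ.≤-Reasoning

ratio-cancel : ∀ a b → b ≢ 0ℚ → ratio a b * b ≡ a
ratio-cancel a b b≢0 with b ℚ.≟ 0ℚ
... | yes b≡0 = contradiction b≡0 b≢0
... | no  b≢0′ = trans (ℚ.*-assoc a _ b)
  (trans (cong (a *_) (ℚ.*-inverseˡ b {{≢-nonZero b≢0′}})) (ℚ.*-identityʳ a))

cross-multiply-≤ : ∀ {α p q p′ q′ r r′} → 0ℚ ≤ α → 0ℚ ≤ p → 0ℚ ≤ q → 0ℚ ≤ q′ →
  (q ≢ 0ℚ → r * q ≡ p) → (q′ ≢ 0ℚ → r′ * q′ ≡ p′) → (q′ ≡ 0ℚ → p′ ≡ 0ℚ) →
  r′ ≤ α * r → p′ * q ≤ α * p * q′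
cross-multiply-≤ {α} {p} {q} {p′} {q′} {r} {r′} 0≤α 0≤p 0≤q 0≤q′ rq≡p r′q′≡p′ empty r′≤αr
  with q ℚ.≟ 0ℚ | q′ ℚ.≟ 0ℚ
... | yes q≡0 | _ rewrite q≡0 =
  ℚ.≤-trans (ℚ.≤-reflexive (ℚ.*-zeroʳ p′)) (*-nonNeg (*-nonNeg 0≤α 0≤p) 0≤q′)
... | no _ | yes q′≡0 rewrite empty q′≡0 =
  ℚ.≤-trans (ℚ.≤-reflexive (ℚ.*-zeroˡ q)) (*-nonNeg (*-nonNeg 0≤α 0≤p) 0≤q′)
... | no q≢0 | no q′≢0 = begin
  p′ * q               ≡⟨ cong (_* q) (sym (r′q′≡p′ q′≢0)) ⟩
  r′ * q′ * q          ≡⟨ ℚ.*-assoc r′ q′ q ⟩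
  r′ * (q′ * q)        ≤⟨ *-monoʳ-≤-0≤ (*-nonNeg 0≤q′ 0≤q) r′≤αr ⟩
  α * r * (q′ * q)     ≡⟨ solve 4 (λ α r q′ q → α :* r :* (q′ :* q) := α :* (r :* q) :* q′)
                                  refl α r q′ q ⟩
  α * (r * q) * q′     ≡⟨ cong (λ z → α * z * q′) (rq≡p q≢0) ⟩
  α * p * q′           ∎
  where open ℚ.≤-Reasoning

-- The potential

module Potential {m} {α : ℚ} (0≤α : 0ℚ ≤ α) (A : MDSPAlg) (approx : ApproxMDSP α A)
  (G : Instance m) (wf : WellFormed G) (0≤p : ∀ w → 0ℚ ≤ prob G w) (p₀≡0 : prob G (root G) ≡ 0ℚ)
  {σ : List (Edge m)} (vσ : ValidSeq G (root G ∷ []) σ)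
  (covers : ∀ w → w ∈ visited (root G ∷ []) σ)
  where

  open Greedy A G wf 0≤p using (tree; treeLength; grow)

  K : ℚ
  K = four * α

  0≤K : 0ℚ ≤ K
  0≤K = *-nonNeg (ℚ.nonNegative⁻¹ four) 0≤α

  histogramσ : List (ℚ × ℚ)
  histogramσ = histogram G (root G ∷ []) σ

  0≤histogram : All (λ s → 0ℚ ≤ proj₁ s × 0ℚ ≤ proj₂ s) histogramσ
  0≤histogram = histogram-nonNeg G (lenE-nonNeg wf) 0≤p (root G ∷ []) σ

  0≤widths : All ((0ℚ ≤_) ∘ proj₁) histogramσ
  0≤widths = All.map proj₁ 0≤histogram

  potential : List (Fin m) → ℚ
  potential S = K * truncatedArea (unvisitedMass G S * ½) histogramσ

  potential-nonNeg : ∀ S → 0ℚ ≤ potential S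
  potential-nonNeg S = *-nonNeg 0≤K
    (truncatedArea-nonNeg (*-nonNeg (weight-nonNeg 0≤p _) (ℚ.nonNegative⁻¹ ½)) 0≤histogram)

  potential-root≤cost : potential (root G ∷ []) ≤ K * cost G σ
  potential-root≤cost = begin
    potential (root G ∷ [])  ≤⟨ *-monoˡ-≤-0≤ 0≤K (truncatedArea≤area _ 0≤widths) ⟩
    K * area histogramσ      ≡⟨ cong (K *_) (sym (unvisitedCost≡area G vσ)) ⟩
    K * unvisitedCost G (root G ∷ []) σ
                             ≡⟨ cong (K *_) (sym (cost≡unvisitedCost G σ)) ⟩
    K * cost G σ             ∎
    where open ℚ.≤-Reasoning

  module _ (S : List (Fin m)) (r∈S : root G ∈ S) where
    open Contraction G S
      using (C; contract-wellFormed; newVertices-outside; contractSeq; contractSeq-valid;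
             contractSeq-treeLen; contractSeq-visits)

    wfC : WellFormed C
    wfC = contract-wellFormed wf r∈S

    0≤treeLenC : ∀ τ → 0ℚ ≤ treeLen C τ
    0≤treeLenC = treeLen-nonNeg {I = C} (lenE-nonNeg wfC)

    λT X X′ P : ℚ
    λT = treeLength S
    X  = unvisitedMass G S
    X′ = unvisitedMass G (grow S)
    P  = treeProb C (tree S)

    vT : IsSubtree C (tree S)
    vT = proj₁ (approx C wfC)

    0≤P : 0ℚ ≤ P
    0≤P = subst (0ℚ ≤_) (sym (treeProb≡weight C p₀≡0 vT)) (weight-nonNeg 0≤p _)

    X≡X′+P : X ≡ X′ + P
    X≡X′+P = trans (unvisitedMass-++ G S (newVertices-outside (here refl) vT))
                   (cong (_+_ X′) (sym (treeProb≡weight C p₀≡0 vT)))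

    module ContractedPrefix {pre} (vpre : ValidSeq G (root G ∷ []) pre) where

      T′ : List (Edge m)
      T′ = contractSeq pre

      vT′ : IsSubtree C T′
      vT′ = contractSeq-valid r∈S vpre (λ w∈ → w∈) (λ w∈ _ → w∈) (here refl)

      Q : ℚ
      Q = unvisitedMass G (visited (root G ∷ []) pre)

      mass-≤ : X ≤ Q + treeProb C T′
      mass-≤ = begin
        X                                                  ≤⟨ ∑-mono-≤ pointwise ⟩
        ∑ (λ w → outside w + inside w)                     ≡⟨ ∑-distrib-+ outside inside ⟩
        Q + weight (prob G) (λ w → elem w (map proj₂ T′))  ≡⟨ cong (_+_ Q)
                                                                (sym (treeProb≡weight C p₀≡0 vT′)) ⟩
        Q + treeProb C T′                                  ∎
        where
        open ℚ.≤-Reasoning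
        outside inside : Fin m → ℚ
        outside w = if not (elem w (visited (root G ∷ []) pre)) then prob G w else 0ℚ
        inside  w = if elem w (map proj₂ T′) then prob G w else 0ℚ
        pointwise : ∀ w → (if not (elem w S) then prob G w else 0ℚ) ≤ outside w + inside w
        pointwise w with elem w S in wS | elem w (visited (root G ∷ []) pre) in wV
                       | elem w (map proj₂ T′) in wT′
        ... | true  | v     | t    = ℚ.+-mono-≤ (if-nonNeg (not v) (0≤p w)) (if-nonNeg t (0≤p w))
        ... | false | false | t    = ℚ.≤-trans (ℚ.≤-reflexive (sym (ℚ.+-identityʳ (prob G w))))
                                              (ℚ.+-monoʳ-≤ (prob G w) (if-nonNeg t (0≤p w)))
        ... | false | true  | true = ℚ.≤-reflexive (sym (ℚ.+-identityˡ (prob G w)))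
        ... | false | true  | false
          with ∈-resp-↭ (↭-sym (++↭visited (root G ∷ []) T′))
                        (contractSeq-visits pre (λ w∈ _ → w∈) (elem⇒∈ _ wV) wS)
        ...   | here refl = case trans (sym (∈⇒elem r∈S)) wS of λ ()
        ...   | there w∈T = case trans (sym (∈⇒elem w∈T)) wT′ of λ ()

      density-≤ : treeProb C T′ * λT ≤ α * P * treeLen C T′
      density-≤ = cross-multiply-≤ 0≤α 0≤P (0≤treeLenC (tree S)) (0≤treeLenC T′)
        (ratio-cancel P λT) (ratio-cancel (treeProb C T′) (treeLen C T′)) trivial
        (proj₂ (approx C wfC) T′ vT′)
        where
        trivial : treeLen C T′ ≡ 0ℚ → treeProb C T′ ≡ 0ℚ
        trivial len≡0 rewrite treeLen≡0⇒[] wfC vT′ len≡0 | p₀≡0 = ℚ.+-identityʳ 0ℚ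

    prefix-bound : ∀ {pre} → ValidSeq G (root G ∷ []) pre →
      λT * X ≤ λT * unvisitedMass G (visited (root G ∷ []) pre) + α * P * treeLen G pre
    prefix-bound {pre} vpre = begin
      λT * X                          ≤⟨ *-monoˡ-≤-0≤ (0≤treeLenC (tree S)) mass-≤ ⟩
      λT * (Q + P′)                   ≡⟨ solve 3 (λ l q p → l :* (q :+ p) := l :* q :+ p :* l)
                                                  refl λT Q P′ ⟩
      λT * Q + P′ * λT                ≤⟨ ℚ.+-monoʳ-≤ (λT * Q) density-≤ ⟩
      λT * Q + α * P * treeLen C T′   ≤⟨ ℚ.+-monoʳ-≤ (λT * Q) (*-monoˡ-≤-0≤ (*-nonNeg 0≤α 0≤P)
                                          (contractSeq-treeLen r∈S (lenE-nonNeg wf) vpre)) ⟩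
      λT * Q + α * P * treeLen G pre  ∎
      where
      open ℚ.≤-Reasoning
      open ContractedPrefix vpre
      P′ : ℚ
      P′ = treeProb C T′

    potential-decrease : λT * X + potential (grow S) ≤ potential S
    potential-decrease = begin
      λT * X + potential (grow S)
        ≤⟨ truncatedArea-exchange (0≤treeLenC (tree S)) (*-nonNeg 0≤α 0≤P) 0≤K c′≤c
             (solve 2 (λ l x → l :* x := con two :* (l :* (x :* con ½))) refl λT X) Kc≡
             histogramσ ℚ.≤-refl 0≤widths bounded ⟩
      two * (α * P * 0ℚ) + potential S
        ≡⟨ solve 3 (λ a p y → con two :* (a :* p :* con 0ℚ) :+ y := y) refl α P (potential S) ⟩
      potential S ∎
      where
      open ℚ.≤-Reasoning
      c′≤c : X′ * ½ ≤ X * ½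
      c′≤c = *-monoʳ-≤-0≤ (ℚ.nonNegative⁻¹ ½) (begin
        X′       ≡⟨ sym (ℚ.+-identityʳ X′) ⟩
        X′ + 0ℚ  ≤⟨ ℚ.+-monoʳ-≤ X′ 0≤P ⟩
        X′ + P   ≡⟨ sym X≡X′+P ⟩
        X        ∎)
      Kc≡ : K * (X * ½) ≡ K * (X′ * ½) + two * (α * P)
      Kc≡ = trans (cong (λ x → K * (x * ½)) X≡X′+P)
        (solve 3 (λ a x p → con four :* a :* ((x :+ p) :* con ½)
                            := con four :* a :* (x :* con ½) :+ con two :* (a :* p))
               refl α X′ P)
      bounded : PrefixBounded (λT * X) λT (α * P) 0ℚ histogramσ
      bounded = histogram-prefixBounded G (root G ∷ []) 0ℚ σ
        (λ pre rest pre++rest≡σ →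
          subst (λ L → λT * X ≤ λT * unvisitedMass G (visited (root G ∷ []) pre) + α * P * L)
                (sym (ℚ.+-identityˡ (treeLen G pre)))
                (prefix-bound (prefix-valid pre
                  (subst (ValidSeq G (root G ∷ [])) (sym pre++rest≡σ) vσ))))
        (unvisitedMass-all G covers)

expandingSearch-visits : ∀ {n} (G : Instance (suc n)) {σ} → ExpSearch G σ →
  ∀ w → w ∈ visited (root G ∷ []) σ
expandingSearch-visits G {σ} (vσ , |σ|≡n) w =
  ∈-resp-↭ (++↭visited (root G ∷ []) σ)
    (unique-length⇒∈ (treeVerts-unique G vσ) (cong suc (trans (length-map proj₂ σ) |σ|≡n)) w)

theorem2 : (α : ℚ) → (+ 1 / 1) ≤ α → (A : MDSPAlg) → ApproxMDSP α A →
    ∀ {n} (G : Instance (suc n)) → ESInstance G →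
    (σg : List (Edge (suc n))) → GreedyOutput A G σg →
    (σ : List (Edge (suc n))) → ExpSearch G σ →
    cost G σg ≤ ((+ 4 / 1) * α) * cost G σ
theorem2 α 1≤α A approx G (wf , _ , p₀≡0 , bounds , _) σg run σ search = begin
  cost G σg                         ≡⟨ cost≡unvisitedCost G σg ⟩
  unvisitedCost G (root G ∷ []) σg  ≤⟨ greedy-cost-≤ potential potential-nonNeg potential-decrease
                                                     run (here refl) ⟩
  potential (root G ∷ [])           ≤⟨ potential-root≤cost ⟩
  ((+ 4 / 1) * α) * cost G σ        ∎
  where
  open ℚ.≤-Reasoning
  0≤p : ∀ w → 0ℚ ≤ prob G w
  0≤p w = proj₁ (bounds w)
  0≤α : 0ℚ ≤ α
  0≤α = ℚ.≤-trans (ℚ.nonNegative⁻¹ (+ 1 / 1)) 1≤α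
  open Greedy A G wf 0≤p using (greedy-cost-≤)
  open Potential 0≤α A approx G wf 0≤p p₀≡0 (proj₁ search) (expandingSearch-visits G search)
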